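{- Let $\chi_1,\chi_2$ be nontrivial primitive Dirichlet characters modulo $q_1,q_2$ respectively, with $\chi_1\chi_2(-1)=1$. Let $\begin{pmatrix}a&b\\c&d\end{pmatrix}\in\Gamma_0(q_1q_2)$ with $c=rq_1q_2$ for some positive integer $r$. Then \[ S_{\chi_1,\chi_2}(a,c)=-\frac{1}{rq_1}\sum_{j=0}^{c-1}\sum_{n=0}^{q_1-1}\overline{\chi_2}(j)\overline{\chi_1}(n)\Big\lfloor\frac{j}{q_2}\Big\rfloor\Big\lfloor\frac{aj}{c}+\frac{n}{q_1}\Big\rfloor. \]
   Context: $B_1(x)=0$ if $x\in\mathbb{Z}$ and $B_1(x)=x-\lfloor x\rfloor-\tfrac12$ otherwise. $\Gamma_0(N)$ is the group of matrices in $SL_2(\mathbb{Z})$ whose lower-left entry is divisible by $N$. For such a matrix with $c\ge1$, \[S_{\chi_1,\chi_2}(a,c)=\sum_{j \bmod c}\ \sum_{n \bmod q_1}\overline{\chi_2}(j)\overline{\chi_1}(n)B_1\Big(\frac{j}{c}\Big)B_1\Big(\frac{n}{q_1}+\frac{aj}{c}\Big).\] -}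

module Defs where

open import Level using (Level; _⊔_; suc)
open import Algebra.Bundles using (CommutativeRing)
open import Algebra.Morphism.Structures using (module RingMorphisms)
open import Data.Nat as ℕ using (ℕ; NonZero)
open import Data.Nat.GCD using (gcd)
open import Data.Nat.Divisibility using (_∣_)
open import Data.Integer as ℤ using (ℤ; +_)
open import Data.Integer.Divisibility as ℤD using ()
open import Data.Rational as ℚ using (ℚ)
import Data.Rational.Properties as ℚP
open import Data.Product using (Σ; _×_)
open import Data.Sum using (_⊎_)
open import Relation.Binary.PropositionalEquality using (_≡_; _≢_)
open import Relation.Nullary using (¬_; yes; no)

-- The paper's characters are complex-valued.  Agda's library has no ℂ, so
-- we work over an arbitrary integral domain K (1 ≠ 0, no zero divisors)
-- which is a ℚ-algebra (comes with a ring homomorphism ι : ℚ → K).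
-- ℂ is such a K; conversely the identity only involves roots of unity and
-- rationals, so the statement over all such K is equivalent to the one
-- over ℂ.

record QDomain (c ℓ : Level) : Set (suc (c ⊔ ℓ)) where
  field
    commRing : CommutativeRing c ℓ
  open CommutativeRing commRing public
  field
    nontrivial : ¬ (1# ≈ 0#)
    noZeroDivisors : ∀ x y → x * y ≈ 0# → (x ≈ 0#) ⊎ (y ≈ 0#)
    ι : ℚ → Carrier
    ι-hom : RingMorphisms.IsRingHomomorphism ℚP.+-*-rawRing rawRing ι

module _ {c ℓ} (K : QDomain c ℓ) where
  open QDomain K

  CoprimeTo : ℤ → ℕ → Set
  CoprimeTo n q = gcd (ℤ.∣ n ∣) q ≡ 1

  record IsDirichletCharacter (q : ℕ) (χ : ℤ → Carrier) : Set (c ⊔ ℓ) where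
    field
      modulus-pos   : NonZero q
      χ-one         : χ (+ 1) ≈ 1#
      χ-mult        : ∀ m n → χ (m ℤ.* n) ≈ χ m * χ n
      χ-periodic    : ∀ n → χ (n ℤ.+ + q) ≈ χ n
      χ-noncoprime  : ∀ n → ¬ CoprimeTo n q → χ n ≈ 0#

  Nontrivial : ℕ → (ℤ → Carrier) → Set ℓ
  Nontrivial q χ = Σ ℤ λ n → CoprimeTo n q × ¬ (χ n ≈ 1#)

  -- χ is primitive mod q: it is not induced from any modulus d ∣ q, d < q,
  -- i.e. for each such d there is n ≡ 1 (mod d), (n,q)=1, with χ(n) ≠ 1.
  Primitive : ℕ → (ℤ → Carrier) → Set ℓ
  Primitive q χ = ∀ d → d ∣ q → d ℕ.< q →
    Σ ℤ λ n → CoprimeTo n q × ((+ d) ℤD.∣ (n ℤ.- + 1)) × ¬ (χ n ≈ 1#)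

  -- χb is the complex conjugate character of χ (mod q): χ̄(n) = χ(n)⁻¹
  -- for (n,q)=1 (values are roots of unity) and 0 otherwise.
  IsConjugate : ℕ → (ℤ → Carrier) → (ℤ → Carrier) → Set ℓ
  IsConjugate q χ χb = ∀ n → (CoprimeTo n q → χb n * χ n ≈ 1#)
                           × (¬ CoprimeTo n q → χb n ≈ 0#)

  sumK : ℕ → (ℕ → Carrier) → Carrier
  sumK ℕ.zero    f = 0#
  sumK (ℕ.suc m) f = sumK m f + f m

B₁ : ℚ → ℚ
B₁ x with ℚ.↧ₙ x ℕ.≟ 1
... | yes _ = ℚ.0ℚ
... | no  _ = x ℚ.- (ℚ.floor x ℚ./ 1) ℚ.- ℚ.½

module _ {c ℓ} (K : QDomain c ℓ) where
  open QDomain K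

  -- S_{χ₁,χ₂}(a,c) for χ₁ mod q₁, written with χ̄₁ = chi1b, χ̄₂ = chi2b:
  -- Σ_{j mod c} Σ_{n mod q₁} χ̄₂(j) χ̄₁(n) B₁(j/c) B₁(n/q₁ + aj/c)
  Ssum : (chi1b chi2b : ℤ → Carrier) (q₁ : ℕ) .{{_ : NonZero q₁}}
         (a : ℤ) (cc : ℕ) .{{_ : NonZero cc}} → Carrier
  Ssum chi1b chi2b q₁ a cc = sumK K cc λ j → sumK K q₁ λ n →
    chi2b (+ j) * chi1b (+ n) *
    ι (B₁ ((+ j) ℚ./ cc) ℚ.* B₁ ((+ n) ℚ./ q₁ ℚ.+ (a ℤ.* + j) ℚ./ cc))

  floorSum : (chi1b chi2b : ℤ → Carrier) (q₁ q₂ : ℕ)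
             .{{_ : NonZero q₁}} .{{_ : NonZero q₂}}
             (a : ℤ) (cc : ℕ) .{{_ : NonZero cc}} → Carrier
  floorSum chi1b chi2b q₁ q₂ a cc = sumK K cc λ j → sumK K q₁ λ n →
    chi2b (+ j) * chi1b (+ n) *
    ι ((+ (j ℕ./ q₂)) ℚ./ 1
       ℚ.* (ℚ.floor ((a ℤ.* + j) ℚ./ cc ℚ.+ (+ n) ℚ./ q₁) ℚ./ 1))

-- Write M = r q₁, so that c = M q₂, and j = k q₂ + l with 0 ≤ l < q₂.  Terms with q₂ ∣ j vanish
-- since χ̄₂(j) = 0.  Otherwise neither j/c nor x = n/q₁ + aj/c is an integer (ad − bc = 1 makes a
-- prime to q₂), so B₁(j/c) B₁(x) = (k/M + l/c − ½)(x − ⌊x⌋ − ½), which expands into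
--   (k/M)(n/q₁) + (k/M)(aj/c − ½) + (l/c − ½)(x − ⌊x⌋ − ½) − (1/M) k ⌊x⌋.
-- Twisted by χ̄₂(j) χ̄₁(n) and summed, the first term dies because Σ_l χ̄₂(l) = 0 and the second
-- because Σ_n χ̄₁(n) = 0.  In the third, c x = (r n + a k) q₂ + a l: the sawtooth is M-periodic in
-- r n + a k, and k ↦ r n + a k permutes the residues mod M because a d ≡ 1 (mod M), so the sum
-- over k does not depend on n and the sum over n kills it.  Only the floor term survives.

module Submission where

open import Defs
open import Data.Nat as ℕ using (ℕ; NonZero; suc; zero)
open import Data.Nat.Properties using (m*n≢0)
import Data.Nat.Properties as ℕP
import Data.Nat.DivMod as ℕ
open import Data.Nat.Divisibility as ℕ using (_∣_)
import Data.Nat.GCD as ℕ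
open import Data.Nat.Coprimality as ℕ using (Coprime)
open import Data.Integer as ℤ using (ℤ; +_; -[1+_])
import Data.Integer.Properties as ℤP
import Data.Integer.Divisibility.Signed as ℤD
open import Data.Integer.DivMod using (a≡a%ℕn+[a/ℕn]*n; n%ℕd<d; div-pos-is-/ℕ; [n/ℕd]*d≤n; n<s[n/ℕd]*d)
open import Data.Integer.Solver using (module +-*-Solver)
open import Data.Rational as ℚ using (ℚ; mkℚ)
import Data.Rational.Properties as ℚP
import Data.Rational.Solver
open import Data.Rational.Unnormalised as ℚᵘ using (*≡*)
import Data.Rational.Unnormalised.Properties as ℚᵘP
open import Data.Fin as Fin using (Fin; toℕ; fromℕ<)
import Data.Fin.Properties as Fin
import Data.Fin.Permutation as Perm
open import Data.Product using (Σ; _,_; proj₁; proj₂)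
open import Data.Sum using (_⊎_; inj₁; inj₂)
open import Function.Base using (_∘_)
open import Relation.Binary.PropositionalEquality using (_≡_; _≢_; refl; sym; trans; cong; cong₂; subst; module ≡-Reasoning)
open import Relation.Nullary using (¬_; yes; no; contradiction)
open import Algebra.Morphism.Structures using (module RingMorphisms)
import Algebra.Properties.CommutativeMonoid.Sum as CommutativeMonoidSum
import Algebra.Solver.Ring.NaturalCoefficients.Default as NaturalCoefficients
open import Algebra.Properties.AbelianGroup ℤP.+-0-abelianGroup using (∙-cancelʳ)

-- Euclidean division

/ℕ-unique : ∀ {x e} q .{{_ : NonZero q}} → e ℤ.* + q ℤ.≤ x → x ℤ.< ℤ.suc e ℤ.* + q → x ℤ./ℕ q ≡ e
/ℕ-unique {x} q lower upper = ℤP.≤-antisym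
  (quotient-≤ ([n/ℕd]*d≤n x q) upper) (quotient-≤ lower (n<s[n/ℕd]*d x q))
  where
  quotient-≤ : ∀ {e e'} → e ℤ.* + q ℤ.≤ x → x ℤ.< ℤ.suc e' ℤ.* + q → e ℤ.≤ e'
  quotient-≤ {e} {e'} lower upper = begin
    e                  ≤⟨ ℤP.i<j⇒i≤pred[j] {e} {ℤ.suc e'} (ℤP.*-cancelʳ-<-nonNeg (+ q) (ℤP.≤-<-trans lower upper)) ⟩
    ℤ.pred (ℤ.suc e')  ≡⟨ ℤP.pred-suc e' ⟩
    e'                 ∎
    where open ℤP.≤-Reasoning

%ℕ-unique : ∀ {x} q .{{_ : NonZero q}} r e → r ℕ.< q → x ≡ + r ℤ.+ e ℤ.* + q → x ℤ.%ℕ q ≡ r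
%ℕ-unique {x} q r e r<q refl = ℤP.+-injective (∙-cancelʳ (e ℤ.* + q) _ _ (begin-equality
  + (x ℤ.%ℕ q) ℤ.+ e ℤ.* + q            ≡⟨ cong (λ f → + (x ℤ.%ℕ q) ℤ.+ f ℤ.* + q) x/q≡e ⟨
  + (x ℤ.%ℕ q) ℤ.+ (x ℤ./ℕ q) ℤ.* + q   ≡⟨ a≡a%ℕn+[a/ℕn]*n x q ⟨
  x                                     ∎))
  where
  open ℤP.≤-Reasoning
  x/q≡e : x ℤ./ℕ q ≡ e
  x/q≡e = /ℕ-unique q (ℤP.i≤j+i (e ℤ.* + q) (+ r)) (begin-strict
    + r ℤ.+ e ℤ.* + q  <⟨ ℤP.+-monoˡ-< (e ℤ.* + q) (ℤ.+<+ r<q) ⟩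
    + q ℤ.+ e ℤ.* + q  ≡⟨ ℤP.suc-* e (+ q) ⟨
    ℤ.suc e ℤ.* + q    ∎)

%ℕ-periodic : ∀ p t q .{{_ : NonZero q}} → (p ℤ.+ t ℤ.* + q) ℤ.%ℕ q ≡ p ℤ.%ℕ q
%ℕ-periodic p t q = %ℕ-unique q (p ℤ.%ℕ q) (p ℤ./ℕ q ℤ.+ t) (n%ℕd<d p q) (begin
  p ℤ.+ t ℤ.* + q                          ≡⟨ cong (λ p → p ℤ.+ t ℤ.* + q) (a≡a%ℕn+[a/ℕn]*n p q) ⟩
  + r ℤ.+ f ℤ.* + q ℤ.+ t ℤ.* + q
    ≡⟨ solve 4 (λ r f t q → r :+ f :* q :+ t :* q := r :+ (f :+ t) :* q) refl (+ r) f t (+ q) ⟩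
  + r ℤ.+ (f ℤ.+ t) ℤ.* + q                ∎)
  where
  open ≡-Reasoning
  open +-*-Solver
  r = p ℤ.%ℕ q
  f = p ℤ./ℕ q

[kq+l]/q≡k : ∀ k {q l} .{{_ : NonZero q}} → l ℕ.< q → (k ℕ.* q ℕ.+ l) ℕ./ q ≡ k
[kq+l]/q≡k k {q} {l} l<q = begin
  (k ℕ.* q ℕ.+ l) ℕ./ q        ≡⟨ ℕ.+-distrib-/-∣ˡ l (ℕ.n∣m*n k) ⟩
  k ℕ.* q ℕ./ q ℕ.+ l ℕ./ q    ≡⟨ cong₂ ℕ._+_ (ℕ.m*n/n≡m k q) (ℕ.m<n⇒m/n≡0 l<q) ⟩
  k ℕ.+ 0                      ≡⟨ ℕP.+-identityʳ k ⟩
  k                            ∎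
  where open ≡-Reasoning

[kq+l]%q≡l : ∀ k {q l} .{{_ : NonZero q}} → l ℕ.< q → (k ℕ.* q ℕ.+ l) ℕ.% q ≡ l
[kq+l]%q≡l k {q} {l} l<q = trans (ℕ.%-remove-+ˡ l (ℕ.n∣m*n k)) (ℕ.m<n⇒m%n≡m l<q)

-- Coprimality and units modulo m

coprime-shift : ∀ x t q → Coprime ℤ.∣ x ℤ.+ t ℤ.* + q ∣ q → Coprime ℤ.∣ x ∣ q
coprime-shift x t q coprime {d} (d∣x , d∣q) = coprime (ℤD.∣⇒∣ᵤ d∣x+tq , d∣q)
  where
  d∣x+tq : + d ℤD.∣ x ℤ.+ t ℤ.* + q
  d∣x+tq = ℤD.∣m∣n⇒∣m+n {+ d} {x} (ℤD.∣ᵤ⇒∣ {+ d} {x} d∣x) (ℤD.∣n⇒∣m*n t (ℤD.∣ᵤ⇒∣ {+ d} {+ q} d∣q))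

coprime-shift⁻¹ : ∀ x t q → Coprime ℤ.∣ x ∣ q → Coprime ℤ.∣ x ℤ.+ t ℤ.* + q ∣ q
coprime-shift⁻¹ x t q coprime = coprime-shift (x ℤ.+ t ℤ.* + q) (ℤ.- t) q
  (subst (λ y → Coprime ℤ.∣ y ∣ q) (solve 3 (λ x t q → x := (x :+ t :* q) :+ (:- t) :* q) refl x t (+ q)) coprime)
  where open +-*-Solver

coprime-* : ∀ {m n q} → Coprime m q → Coprime n q → Coprime (m ℕ.* n) q
coprime-* {m} m⊥q n⊥q {d} (d∣mn , d∣q) = n⊥q (ℕ.coprime-divisor d⊥m d∣mn , d∣q)
  where
  d⊥m : Coprime d m
  d⊥m (e∣d , e∣m) = m⊥q (e∣m , ℕ.∣-trans e∣d d∣q)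

coprime-*-factor : ∀ m {n q} → Coprime (m ℕ.* n) q → Coprime n q
coprime-*-factor m mn⊥q (d∣n , d∣q) = mn⊥q (ℕ.∣-trans d∣n (ℕ.n∣m*n m) , d∣q)

modular-inverse : ∀ t q → Coprime ℤ.∣ t ∣ q → Σ ℤ λ u → Σ ℤ λ e → t ℤ.* u ≡ + 1 ℤ.+ e ℤ.* + q
modular-inverse t q t⊥q = signed t (unsigned (ℕ.coprime-Bézout t⊥q))
  where
  open ≡-Reasoning
  open +-*-Solver
  m = ℤ.∣ t ∣
  lift : ∀ {a b c d e} → a ℕ.+ b ℕ.* c ≡ d ℕ.* e → + a ℤ.+ + b ℤ.* + c ≡ + d ℤ.* + e
  lift {a} {b} {c} {d} {e} eq = begin
    + a ℤ.+ + b ℤ.* + c  ≡⟨ cong (ℤ._+_ (+ a)) (ℤP.pos-* b c) ⟨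
    + (a ℕ.+ b ℕ.* c)    ≡⟨ cong +_ eq ⟩
    + (d ℕ.* e)          ≡⟨ ℤP.pos-* d e ⟩
    + d ℤ.* + e          ∎
  unsigned : ℕ.Bézout.Identity 1 m q → Σ ℤ λ u → Σ ℤ λ e → + m ℤ.* u ≡ + 1 ℤ.+ e ℤ.* + q
  unsigned (ℕ.Bézout.+- x y eq) = + x , + y , (begin
    + m ℤ.* + x          ≡⟨ ℤP.*-comm (+ m) (+ x) ⟩
    + x ℤ.* + m          ≡⟨ lift {1} {y} {q} {x} {m} eq ⟨
    + 1 ℤ.+ + y ℤ.* + q  ∎)
  unsigned (ℕ.Bézout.-+ x y eq) = ℤ.- + x , ℤ.- + y , (begin
    + m ℤ.* ℤ.- + x
      ≡⟨ solve 2 (λ m x → m :* (:- x) := con (+ 1) :- (con (+ 1) :+ x :* m)) refl (+ m) (+ x) ⟩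
    + 1 ℤ.- (+ 1 ℤ.+ + x ℤ.* + m)
      ≡⟨ cong (λ z → + 1 ℤ.- z) (lift {1} {x} {m} {y} {q} eq) ⟩
    + 1 ℤ.- + y ℤ.* + q
      ≡⟨ solve 2 (λ y q → con (+ 1) :- y :* q := con (+ 1) :+ (:- y) :* q) refl (+ y) (+ q) ⟩
    + 1 ℤ.+ ℤ.- + y ℤ.* + q
      ∎)
  signed : ∀ t → (Σ ℤ λ u → Σ ℤ λ e → + ℤ.∣ t ∣ ℤ.* u ≡ + 1 ℤ.+ e ℤ.* + q) →
           Σ ℤ λ u → Σ ℤ λ e → t ℤ.* u ≡ + 1 ℤ.+ e ℤ.* + q
  signed (+ n)    (u , e , eq) = u , e , eq
  signed -[1+ n ] (u , e , eq) = ℤ.- u , e , trans (solve 2 (λ n u → (:- n) :* (:- u) := n :* u) refl (+ suc n) u) eq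

det≡1⇒coprime : ∀ {a b d} m q → a ℤ.* d ℤ.- b ℤ.* + (m ℕ.* q) ≡ + 1 → Coprime q ℤ.∣ a ∣
det≡1⇒coprime {a} {b} {d} m q det {g} (g∣q , g∣a) = ℕ.∣1⇒≡1 (ℤD.∣⇒∣ᵤ (subst (+ g ℤD.∣_) det g∣ad-bc))
  where
  g∣ad : + g ℤD.∣ a ℤ.* d
  g∣ad = ℤD.∣m⇒∣m*n {+ g} {a} d (ℤD.∣ᵤ⇒∣ {+ g} {a} g∣a)
  g∣bc : + g ℤD.∣ b ℤ.* + (m ℕ.* q)
  g∣bc = ℤD.∣n⇒∣m*n b (ℤD.∣ᵤ⇒∣ {+ g} {+ (m ℕ.* q)} (ℕ.∣-trans g∣q (ℕ.n∣m*n m)))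
  g∣ad-bc : + g ℤD.∣ a ℤ.* d ℤ.- b ℤ.* + (m ℕ.* q)
  g∣ad-bc = ℤD.∣m∣n⇒∣m-n {+ g} {a ℤ.* d} g∣ad g∣bc

det≡1⇒unit : ∀ {a b d} m q → a ℤ.* d ℤ.- b ℤ.* + (m ℕ.* q) ≡ + 1 → a ℤ.* d ≡ + 1 ℤ.+ (b ℤ.* + q) ℤ.* + m
det≡1⇒unit {a} {b} {d} m q det = begin
  a ℤ.* d
    ≡⟨ solve 2 (λ ad bc → ad := (ad :- bc) :+ bc) refl (a ℤ.* d) (b ℤ.* + (m ℕ.* q)) ⟩
  (a ℤ.* d ℤ.- b ℤ.* + (m ℕ.* q)) ℤ.+ b ℤ.* + (m ℕ.* q)
    ≡⟨ cong₂ ℤ._+_ det (cong (b ℤ.*_) (ℤP.pos-* m q)) ⟩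
  + 1 ℤ.+ b ℤ.* (+ m ℤ.* + q)
    ≡⟨ solve 3 (λ b m q → con (+ 1) :+ b :* (m :* q) := con (+ 1) :+ (b :* q) :* m) refl b (+ m) (+ q) ⟩
  + 1 ℤ.+ (b ℤ.* + q) ℤ.* + m
    ∎
  where
  open ≡-Reasoning
  open +-*-Solver

affine-inverseˡ : ∀ {a u e m} → a ℤ.* u ≡ + 1 ℤ.+ e ℤ.* m → ∀ s y r f →
                  s ℤ.+ a ℤ.* y ≡ r ℤ.+ f ℤ.* m → u ℤ.* (r ℤ.- s) ≡ y ℤ.+ (e ℤ.* y ℤ.- u ℤ.* f) ℤ.* m
affine-inverseˡ {a} {u} {e} {m} au≡1 s y r f r≡ = begin
  u ℤ.* (r ℤ.- s)
    ≡⟨ solve 5 (λ u r s f m → u :* (r :- s) := u :* ((r :+ f :* m) :- s) :- u :* f :* m) refl u r s f m ⟩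
  u ℤ.* ((r ℤ.+ f ℤ.* m) ℤ.- s) ℤ.- u ℤ.* f ℤ.* m
    ≡⟨ cong (λ x → u ℤ.* (x ℤ.- s) ℤ.- u ℤ.* f ℤ.* m) r≡ ⟨
  u ℤ.* ((s ℤ.+ a ℤ.* y) ℤ.- s) ℤ.- u ℤ.* f ℤ.* m
    ≡⟨ solve 6 (λ a u s y f m → u :* ((s :+ a :* y) :- s) :- u :* f :* m
                              := (a :* u) :* y :- u :* f :* m) refl a u s y f m ⟩
  (a ℤ.* u) ℤ.* y ℤ.- u ℤ.* f ℤ.* m
    ≡⟨ cong (λ au → au ℤ.* y ℤ.- u ℤ.* f ℤ.* m) au≡1 ⟩
  (+ 1 ℤ.+ e ℤ.* m) ℤ.* y ℤ.- u ℤ.* f ℤ.* m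
    ≡⟨ solve 5 (λ u e y f m → (con (+ 1) :+ e :* m) :* y :- u :* f :* m
                            := y :+ (e :* y :- u :* f) :* m) refl u e y f m ⟩
  y ℤ.+ (e ℤ.* y ℤ.- u ℤ.* f) ℤ.* m
    ∎
  where
  open ≡-Reasoning
  open +-*-Solver

affine-inverseʳ : ∀ {a u e m} → a ℤ.* u ≡ + 1 ℤ.+ e ℤ.* m → ∀ s y r f →
                  u ℤ.* (y ℤ.- s) ≡ r ℤ.+ f ℤ.* m → s ℤ.+ a ℤ.* r ≡ y ℤ.+ (e ℤ.* (y ℤ.- s) ℤ.- a ℤ.* f) ℤ.* m
affine-inverseʳ {a} {u} {e} {m} au≡1 s y r f r≡ = begin
  s ℤ.+ a ℤ.* r
    ≡⟨ solve 5 (λ a s r f m → s :+ a :* r := s :+ a :* (r :+ f :* m) :- a :* f :* m) refl a s r f m ⟩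
  s ℤ.+ a ℤ.* (r ℤ.+ f ℤ.* m) ℤ.- a ℤ.* f ℤ.* m
    ≡⟨ cong (λ x → s ℤ.+ a ℤ.* x ℤ.- a ℤ.* f ℤ.* m) r≡ ⟨
  s ℤ.+ a ℤ.* (u ℤ.* (y ℤ.- s)) ℤ.- a ℤ.* f ℤ.* m
    ≡⟨ solve 6 (λ a u s y f m → s :+ a :* (u :* (y :- s)) :- a :* f :* m
                              := s :+ (a :* u) :* (y :- s) :- a :* f :* m) refl a u s y f m ⟩
  s ℤ.+ (a ℤ.* u) ℤ.* (y ℤ.- s) ℤ.- a ℤ.* f ℤ.* m
    ≡⟨ cong (λ au → s ℤ.+ au ℤ.* (y ℤ.- s) ℤ.- a ℤ.* f ℤ.* m) au≡1 ⟩
  s ℤ.+ (+ 1 ℤ.+ e ℤ.* m) ℤ.* (y ℤ.- s) ℤ.- a ℤ.* f ℤ.* m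
    ≡⟨ solve 6 (λ a e s y f m → s :+ (con (+ 1) :+ e :* m) :* (y :- s) :- a :* f :* m
                              := y :+ (e :* (y :- s) :- a :* f) :* m) refl a e s y f m ⟩
  y ℤ.+ (e ℤ.* (y ℤ.- s) ℤ.- a ℤ.* f) ℤ.* m
    ∎
  where
  open ≡-Reasoning
  open +-*-Solver

-- Fractions, the sawtooth function and B₁

toℚᵘ-/ : ∀ p q .{{_ : NonZero q}} → ℚ.toℚᵘ (p ℚ./ q) ℚᵘ.≃ p ℚᵘ./ q
toℚᵘ-/ p (suc q) = ℚP.toℚᵘ-fromℚᵘ (p ℚᵘ./ suc q)

/-cross : ∀ p q p' q' .{{_ : NonZero q}} .{{_ : NonZero q'}} →
          p ℤ.* + q' ≡ p' ℤ.* + q → p ℚ./ q ≡ p' ℚ./ q'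
/-cross p q@(suc _) p' q'@(suc _) eq = ℚP.fromℚᵘ-cong {p ℚᵘ./ q} {p' ℚᵘ./ q'} (*≡* eq)

+-/ : ∀ p q p' q' .{{_ : NonZero q}} .{{_ : NonZero q'}} →
      p ℚ./ q ℚ.+ p' ℚ./ q' ≡ ℚ._/_ (p ℤ.* + q' ℤ.+ p' ℤ.* + q) (q ℕ.* q') {{m*n≢0 q q'}}
+-/ p q@(suc _) p' q'@(suc _) = ℚP.toℚᵘ-injective (begin
  ℚ.toℚᵘ (p ℚ./ q ℚ.+ p' ℚ./ q')                          ≈⟨ ℚP.toℚᵘ-homo-+ (p ℚ./ q) (p' ℚ./ q') ⟩
  ℚ.toℚᵘ (p ℚ./ q) ℚᵘ.+ ℚ.toℚᵘ (p' ℚ./ q')                ≈⟨ ℚᵘP.+-cong (toℚᵘ-/ p q) (toℚᵘ-/ p' q') ⟩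
  p ℚᵘ./ q ℚᵘ.+ p' ℚᵘ./ q'                                ≈⟨ toℚᵘ-/ _ (q ℕ.* q') ⟨
  ℚ.toℚᵘ (ℚ._/_ (p ℤ.* + q' ℤ.+ p' ℤ.* + q) (q ℕ.* q'))  ∎)
  where open ℚᵘP.≃-Reasoning

*-/ : ∀ p q p' q' .{{_ : NonZero q}} .{{_ : NonZero q'}} →
      (p ℚ./ q) ℚ.* (p' ℚ./ q') ≡ ℚ._/_ (p ℤ.* p') (q ℕ.* q') {{m*n≢0 q q'}}
*-/ p q@(suc _) p' q'@(suc _) = ℚP.toℚᵘ-injective (begin
  ℚ.toℚᵘ ((p ℚ./ q) ℚ.* (p' ℚ./ q'))        ≈⟨ ℚP.toℚᵘ-homo-* (p ℚ./ q) (p' ℚ./ q') ⟩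
  ℚ.toℚᵘ (p ℚ./ q) ℚᵘ.* ℚ.toℚᵘ (p' ℚ./ q')  ≈⟨ ℚᵘP.*-cong (toℚᵘ-/ p q) (toℚᵘ-/ p' q') ⟩
  (p ℚᵘ./ q) ℚᵘ.* (p' ℚᵘ./ q')              ≈⟨ toℚᵘ-/ _ (q ℕ.* q') ⟨
  ℚ.toℚᵘ (ℚ._/_ (p ℤ.* p') (q ℕ.* q'))      ∎)
  where open ℚᵘP.≃-Reasoning

-‿/ : ∀ p q .{{_ : NonZero q}} → ℚ.- (p ℚ./ q) ≡ (ℤ.- p) ℚ./ q
-‿/ p q@(suc _) = ℚP.toℚᵘ-injective (begin
  ℚ.toℚᵘ (ℚ.- (p ℚ./ q))    ≈⟨ ℚP.toℚᵘ-homo‿- (p ℚ./ q) ⟩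
  ℚᵘ.- ℚ.toℚᵘ (p ℚ./ q)     ≈⟨ ℚᵘP.-‿cong (toℚᵘ-/ p q) ⟩
  ℚᵘ.- (p ℚᵘ./ q)           ≈⟨ toℚᵘ-/ (ℤ.- p) q ⟨
  ℚ.toℚᵘ ((ℤ.- p) ℚ./ q)    ∎)
  where open ℚᵘP.≃-Reasoning

floor-/ : ∀ p q .{{_ : NonZero q}} → ℚ.floor (p ℚ./ q) ≡ p ℤ./ℕ q
floor-/ p q@(suc _) = floor-cross (p ℚ./ q) (toℚᵘ-/ p q)
  where
  floor-cross : ∀ x → ℚ.toℚᵘ x ℚᵘ.≃ p ℚᵘ./ q → ℚ.floor x ≡ p ℤ./ℕ q
  floor-cross (mkℚ n d₋₁ _) (*≡* nq≡pd) = trans (div-pos-is-/ℕ n d) (sym (/ℕ-unique q lower upper))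
    where
    open ℤP.≤-Reasoning
    open +-*-Solver
    d = suc d₋₁
    f = n ℤ./ℕ d
    lower : f ℤ.* + q ℤ.≤ p
    lower = ℤP.*-cancelʳ-≤-pos _ _ (+ d) (begin
      f ℤ.* + q ℤ.* + d    ≡⟨ solve 3 (λ f q d → f :* q :* d := f :* d :* q) refl f (+ q) (+ d) ⟩
      f ℤ.* + d ℤ.* + q    ≤⟨ ℤP.*-monoʳ-≤-nonNeg (+ q) ([n/ℕd]*d≤n n d) ⟩
      n ℤ.* + q            ≡⟨ nq≡pd ⟩
      p ℤ.* + d            ∎)
    upper : p ℤ.< ℤ.suc f ℤ.* + q
    upper = ℤP.*-cancelʳ-<-nonNeg (+ d) (begin-strict
      p ℤ.* + d                  ≡⟨ nq≡pd ⟨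
      n ℤ.* + q                  <⟨ ℤP.*-monoʳ-<-pos (+ q) (n<s[n/ℕd]*d n d) ⟩
      ℤ.suc f ℤ.* + d ℤ.* + q    ≡⟨ solve 3 (λ f q d → f :* d :* q := f :* q :* d) refl (ℤ.suc f) (+ q) (+ d) ⟩
      ℤ.suc f ℤ.* + q ℤ.* + d    ∎)

↧ₙ-/≡1⇒∣ : ∀ p q .{{_ : NonZero q}} → ℚ.↧ₙ (p ℚ./ q) ≡ 1 → q ∣ ℤ.∣ p ∣
↧ₙ-/≡1⇒∣ p q ↧≡1 = subst (_∣ ℤ.∣ p ∣) gcd≡q (ℕ.gcd[m,n]∣m ℤ.∣ p ∣ q)
  where
  gcd≡q : ℕ.gcd ℤ.∣ p ∣ q ≡ q
  gcd≡q = ℤP.+-injective (begin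
    + ℕ.gcd ℤ.∣ p ∣ q                        ≡⟨ ℤP.*-identityˡ _ ⟨
    + 1 ℤ.* + ℕ.gcd ℤ.∣ p ∣ q                ≡⟨ cong (λ d → + d ℤ.* + ℕ.gcd ℤ.∣ p ∣ q) ↧≡1 ⟨
    ℚ.↧ (p ℚ./ q) ℤ.* + ℕ.gcd ℤ.∣ p ∣ q      ≡⟨ ℚP.↧-/ p q ⟩
    + q                                      ∎)
    where open ≡-Reasoning

sawtooth : ℚ → ℚ
sawtooth x = x ℚ.- ℚ.floor x ℚ./ 1 ℚ.- ℚ.½

sawtooth-/ : ∀ p q .{{_ : NonZero q}} → sawtooth (p ℚ./ q) ≡ + (p ℤ.%ℕ q) ℚ./ q ℚ.- ℚ.½
sawtooth-/ p q = cong (ℚ._- ℚ.½) (begin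
  p ℚ./ q ℚ.- ℚ.floor (p ℚ./ q) ℚ./ 1
    ≡⟨ cong (λ f → p ℚ./ q ℚ.- f ℚ./ 1) (floor-/ p q) ⟩
  p ℚ./ q ℚ.- f ℚ./ 1
    ≡⟨ cong (p ℚ./ q ℚ.+_) (-‿/ f 1) ⟩
  p ℚ./ q ℚ.+ (ℤ.- f) ℚ./ 1
    ≡⟨ +-/ p q (ℤ.- f) 1 ⟩
  ℚ._/_ (p ℤ.* + 1 ℤ.+ ℤ.- f ℤ.* + q) (q ℕ.* 1) {{m*n≢0 q 1}}
    ≡⟨ /-cross (p ℤ.* + 1 ℤ.+ ℤ.- f ℤ.* + q) (q ℕ.* 1) (+ r) q {{m*n≢0 q 1}} cross ⟩
  + r ℚ./ q
    ∎)
  where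
  open ≡-Reasoning
  open +-*-Solver
  r = p ℤ.%ℕ q
  f = p ℤ./ℕ q
  cross : (p ℤ.* + 1 ℤ.+ ℤ.- f ℤ.* + q) ℤ.* + q ≡ + r ℤ.* + (q ℕ.* 1)
  cross = begin
    (p ℤ.* + 1 ℤ.+ ℤ.- f ℤ.* + q) ℤ.* + q
      ≡⟨ cong (λ p → (p ℤ.* + 1 ℤ.+ ℤ.- f ℤ.* + q) ℤ.* + q) (a≡a%ℕn+[a/ℕn]*n p q) ⟩
    ((+ r ℤ.+ f ℤ.* + q) ℤ.* + 1 ℤ.+ ℤ.- f ℤ.* + q) ℤ.* + q
      ≡⟨ solve 3 (λ r f q → ((r :+ f :* q) :* con (+ 1) :+ (:- f) :* q) :* q := r :* (q :* con (+ 1)))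
                 refl (+ r) f (+ q) ⟩
    + r ℤ.* (+ q ℤ.* + 1)
      ≡⟨ cong (+ r ℤ.*_) (ℤP.pos-* q 1) ⟨
    + r ℤ.* + (q ℕ.* 1) ∎

sawtooth-periodic : ∀ p t q .{{_ : NonZero q}} → sawtooth ((p ℤ.+ t ℤ.* + q) ℚ./ q) ≡ sawtooth (p ℚ./ q)
sawtooth-periodic p t q = begin
  sawtooth ((p ℤ.+ t ℤ.* + q) ℚ./ q)         ≡⟨ sawtooth-/ (p ℤ.+ t ℤ.* + q) q ⟩
  + ((p ℤ.+ t ℤ.* + q) ℤ.%ℕ q) ℚ./ q ℚ.- ℚ.½ ≡⟨ cong (λ r → + r ℚ./ q ℚ.- ℚ.½) (%ℕ-periodic p t q) ⟩
  + (p ℤ.%ℕ q) ℚ./ q ℚ.- ℚ.½                 ≡⟨ sawtooth-/ p q ⟨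
  sawtooth (p ℚ./ q)                         ∎
  where open ≡-Reasoning

B₁-nonInteger : ∀ x → ℚ.↧ₙ x ≢ 1 → B₁ x ≡ sawtooth x
B₁-nonInteger x ↧≢1 with ℚ.↧ₙ x ℕ.≟ 1
... | yes ↧≡1 = contradiction ↧≡1 ↧≢1
... | no _    = refl

B₁-/ : ∀ p q .{{_ : NonZero q}} → ¬ q ∣ ℤ.∣ p ∣ → B₁ (p ℚ./ q) ≡ sawtooth (p ℚ./ q)
B₁-/ p q q∤p = B₁-nonInteger (p ℚ./ q) (λ ↧≡1 → q∤p (↧ₙ-/≡1⇒∣ p q ↧≡1))

B₁-proper : ∀ {j} q .{{_ : NonZero q}} → 0 ℕ.< j → j ℕ.< q → B₁ (+ j ℚ./ q) ≡ + j ℚ./ q ℚ.- ℚ.½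
B₁-proper {j} q 0<j j<q = begin
  B₁ (+ j ℚ./ q)                ≡⟨ B₁-/ (+ j) q (λ q∣j → ℕP.<⇒≱ j<q (ℕ.∣⇒≤ ⦃ ℕ.>-nonZero 0<j ⦄ q∣j)) ⟩
  sawtooth (+ j ℚ./ q)          ≡⟨ sawtooth-/ (+ j) q ⟩
  + (j ℕ.% q) ℚ./ q ℚ.- ℚ.½     ≡⟨ cong (λ r → + r ℚ./ q ℚ.- ℚ.½) (ℕ.m<n⇒m%n≡m j<q) ⟩
  + j ℚ./ q ℚ.- ℚ.½             ∎
  where open ≡-Reasoning

product-expansion : ∀ u w v n y f h →
  (u ℚ.* w ℚ.+ v ℚ.- h) ℚ.* ((n ℚ.+ y) ℚ.- f ℚ.- h) ≡
  (((u ℚ.* w) ℚ.* n ℚ.+ (u ℚ.* w ℚ.* (y ℚ.- h)) ℚ.* ℚ.1ℚ) ℚ.+ (v ℚ.- h) ℚ.* ((n ℚ.+ y) ℚ.- f ℚ.- h))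
    ℚ.+ (ℚ.- w) ℚ.* (u ℚ.* f)
product-expansion = solve 7 (λ u w v n y f h →
  (u :* w :+ v :- h) :* ((n :+ y) :- f :- h) :=
  (((u :* w) :* n :+ (u :* w :* (y :- h)) :* con ℚ.1ℚ) :+ (v :- h) :* ((n :+ y) :- f :- h)) :+ (:- w) :* (u :* f)) refl
  where open Data.Rational.Solver.+-*-Solver

-- Finite sums and Dirichlet characters with values in K

module _ {c ℓ} (K : QDomain c ℓ) where
  open QDomain K renaming (refl to ≈-refl; sym to ≈-sym; trans to ≈-trans)
  open import Relation.Binary.Reasoning.Setoid setoid
  open import Algebra.Properties.Ring ring using (-‿distribˡ-*; x∙y⁻¹≈ε⇒x≈y)
  open import Algebra.Properties.CommutativeSemigroup +-commutativeSemigroup using () renaming (interchange to +-interchange)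

  private
    ∑ : ℕ → (ℕ → Carrier) → Carrier
    ∑ = sumK K

  sum-cong : ∀ m {f g : ℕ → Carrier} → (∀ i → i ℕ.< m → f i ≈ g i) → ∑ m f ≈ ∑ m g
  sum-cong zero    f≈g = ≈-refl
  sum-cong (suc m) f≈g = +-cong (sum-cong m (λ i i<m → f≈g i (ℕP.m<n⇒m<1+n i<m))) (f≈g m ℕP.≤-refl)

  sum-zero : ∀ m {f : ℕ → Carrier} → (∀ i → i ℕ.< m → f i ≈ 0#) → ∑ m f ≈ 0#
  sum-zero zero    f≈0 = ≈-refl
  sum-zero (suc m) f≈0 = begin
    ∑ m _ + _   ≈⟨ +-cong (sum-zero m (λ i i<m → f≈0 i (ℕP.m<n⇒m<1+n i<m))) (f≈0 m ℕP.≤-refl) ⟩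
    0# + 0#     ≈⟨ +-identityˡ 0# ⟩
    0#          ∎

  sum-+ : ∀ m (f g : ℕ → Carrier) → ∑ m (λ i → f i + g i) ≈ ∑ m f + ∑ m g
  sum-+ zero    f g = ≈-sym (+-identityˡ 0#)
  sum-+ (suc m) f g = ≈-trans (+-congʳ (sum-+ m f g)) (+-interchange _ _ _ _)

  sum-*ˡ : ∀ m x (f : ℕ → Carrier) → ∑ m (λ i → x * f i) ≈ x * ∑ m f
  sum-*ˡ zero    x f = ≈-sym (zeroʳ x)
  sum-*ˡ (suc m) x f = ≈-trans (+-congʳ (sum-*ˡ m x f)) (≈-sym (distribˡ x _ _))

  sum-*ʳ : ∀ m x (f : ℕ → Carrier) → ∑ m (λ i → f i * x) ≈ ∑ m f * x
  sum-*ʳ zero    x f = ≈-sym (zeroˡ x)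
  sum-*ʳ (suc m) x f = ≈-trans (+-congʳ (sum-*ʳ m x f)) (≈-sym (distribʳ x _ _))

  sum-swap : ∀ m n (f : ℕ → ℕ → Carrier) → ∑ m (λ i → ∑ n (f i)) ≈ ∑ n (λ j → ∑ m (λ i → f i j))
  sum-swap zero    n f = ≈-sym (sum-zero n (λ _ _ → ≈-refl))
  sum-swap (suc m) n f = ≈-trans (+-congʳ (sum-swap m n f)) (≈-sym (sum-+ n _ (f m)))

  sum-++ : ∀ m n (f : ℕ → Carrier) → ∑ (m ℕ.+ n) f ≈ ∑ m f + ∑ n (λ i → f (m ℕ.+ i))
  sum-++ m zero    f rewrite ℕP.+-identityʳ m = ≈-sym (+-identityʳ _)
  sum-++ m (suc n) f rewrite ℕP.+-suc m n    = ≈-trans (+-congʳ (sum-++ m n f)) (+-assoc _ _ _)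

  sum-blocks : ∀ m q (f : ℕ → Carrier) → ∑ (m ℕ.* q) f ≈ ∑ m (λ k → ∑ q (λ l → f (k ℕ.* q ℕ.+ l)))
  sum-blocks zero    q f = ≈-refl
  sum-blocks (suc m) q f = begin
    ∑ (q ℕ.+ m ℕ.* q) f                             ≡⟨ cong (λ n → ∑ n f) (ℕP.+-comm q (m ℕ.* q)) ⟩
    ∑ (m ℕ.* q ℕ.+ q) f                             ≈⟨ sum-++ (m ℕ.* q) q f ⟩
    ∑ (m ℕ.* q) f + ∑ q (λ l → f (m ℕ.* q ℕ.+ l))   ≈⟨ +-congʳ (sum-blocks m q f) ⟩
    ∑ (suc m) (λ k → ∑ q (λ l → f (k ℕ.* q ℕ.+ l))) ∎

  private
    module FinSum = CommutativeMonoidSum +-commutativeMonoid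

    ∑≈FinSum : ∀ m (f : ℕ → Carrier) → ∑ m f ≈ FinSum.sum {m} (f ∘ toℕ)
    ∑≈FinSum zero    f = ≈-refl
    ∑≈FinSum (suc m) f = begin
      ∑ (1 ℕ.+ m) f                 ≈⟨ sum-++ 1 m f ⟩
      (0# + f 0) + ∑ m (f ∘ suc)    ≈⟨ +-cong (+-identityˡ (f 0)) (∑≈FinSum m (f ∘ suc)) ⟩
      FinSum.sum {suc m} (f ∘ toℕ)  ∎

  sum-reindex : ∀ m (f : ℕ → Carrier) (σ τ : ℕ → ℕ) →
                (∀ i → σ i ℕ.< m) → (∀ i → τ i ℕ.< m) →
                (∀ i → i ℕ.< m → τ (σ i) ≡ i) → (∀ i → i ℕ.< m → σ (τ i) ≡ i) →
                ∑ m (f ∘ σ) ≈ ∑ m f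
  sum-reindex m f σ τ σ<m τ<m τσ στ = begin
    ∑ m (f ∘ σ)                   ≈⟨ ∑≈FinSum m (f ∘ σ) ⟩
    FinSum.sum {m} (f ∘ σ ∘ toℕ)  ≡⟨ FinSum.sum-cong-≗ {m} (λ i → cong f (Fin.toℕ-fromℕ< (σ<m (toℕ i)))) ⟨
    FinSum.sum {m} (f ∘ toℕ ∘ σ̂)  ≈⟨ FinSum.sum-permute (f ∘ toℕ) π ⟨
    FinSum.sum {m} (f ∘ toℕ)      ≈⟨ ∑≈FinSum m f ⟨
    ∑ m f                         ∎
    where
    σ̂ τ̂ : Fin m → Fin m
    σ̂ i = fromℕ< (σ<m (toℕ i))
    τ̂ i = fromℕ< (τ<m (toℕ i))
    inverse : ∀ ρ ρ' (ρ<m : ∀ i → ρ i ℕ.< m) (ρ'<m : ∀ i → ρ' i ℕ.< m) → (∀ i → i ℕ.< m → ρ (ρ' i) ≡ i) →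
              ∀ i → fromℕ< (ρ<m (toℕ (fromℕ< (ρ'<m (toℕ i))))) ≡ i
    inverse ρ ρ' ρ<m ρ'<m ρρ' i = Fin.toℕ-injective (trans (Fin.toℕ-fromℕ< (ρ<m _))
      (trans (cong ρ (Fin.toℕ-fromℕ< (ρ'<m (toℕ i)))) (ρρ' (toℕ i) (Fin.toℕ<n i))))
    π : Perm.Permutation m m
    π = Perm.permutation σ̂ τ̂ (inverse σ τ σ<m τ<m στ) (inverse τ σ τ<m σ<m τσ)

  Periodic : ℕ → (ℤ → Carrier) → Set ℓ
  Periodic m g = ∀ z t → g (z ℤ.+ t ℤ.* + m) ≈ g z

  periodic : ∀ m (g : ℤ → Carrier) → (∀ z → g (z ℤ.+ + m) ≈ g z) → Periodic m g
  periodic m g step = periodic-ℤ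
    where
    open +-*-Solver
    periodic-ℕ : ∀ z n → g (z ℤ.+ + n ℤ.* + m) ≈ g z
    periodic-ℕ z zero    = reflexive (cong g (solve 2 (λ z m → z :+ con (+ 0) :* m := z) refl z (+ m)))
    periodic-ℕ z (suc n) = begin
      g (z ℤ.+ + suc n ℤ.* + m)
        ≡⟨ cong g (solve 3 (λ z n m → z :+ (con (+ 1) :+ n) :* m := (z :+ n :* m) :+ m) refl z (+ n) (+ m)) ⟩
      g ((z ℤ.+ + n ℤ.* + m) ℤ.+ + m)
        ≈⟨ step _ ⟩
      g (z ℤ.+ + n ℤ.* + m)
        ≈⟨ periodic-ℕ z n ⟩
      g z
        ∎
    periodic-ℤ : Periodic m g
    periodic-ℤ z (+ n)    = periodic-ℕ z n
    periodic-ℤ z -[1+ n ] = ≈-sym (begin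
      g z
        ≡⟨ cong g (solve 3 (λ z n m → z := (z :+ (:- (con (+ 1) :+ n)) :* m) :+ (con (+ 1) :+ n) :* m)
                         refl z (+ n) (+ m)) ⟩
      g ((z ℤ.+ -[1+ n ] ℤ.* + m) ℤ.+ + suc n ℤ.* + m)
        ≈⟨ periodic-ℕ _ (suc n) ⟩
      g (z ℤ.+ -[1+ n ] ℤ.* + m)
        ∎)

  sum-affine-invariant : ∀ m .{{_ : NonZero m}} {g : ℤ → Carrier} → Periodic m g →
                         ∀ {a u e} → a ℤ.* u ≡ + 1 ℤ.+ e ℤ.* + m → ∀ s →
                         ∑ m (λ k → g (s ℤ.+ a ℤ.* + k)) ≈ ∑ m (λ k → g (+ k))
  sum-affine-invariant m {g} g-periodic {a} {u} {e} au≡1 s = begin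
    ∑ m (λ k → g (s ℤ.+ a ℤ.* + k))   ≈⟨ sum-cong m (λ k _ → reduce (s ℤ.+ a ℤ.* + k)) ⟩
    ∑ m (g ∘ +_ ∘ σ)                  ≈⟨ sum-reindex m (g ∘ +_) σ τ σ<m τ<m τσ στ ⟩
    ∑ m (g ∘ +_)                      ∎
    where
    reduce : ∀ x → g x ≈ g (+ (x ℤ.%ℕ m))
    reduce x = ≈-trans (reflexive (cong g (a≡a%ℕn+[a/ℕn]*n x m))) (g-periodic (+ (x ℤ.%ℕ m)) (x ℤ./ℕ m))
    σ τ : ℕ → ℕ
    σ k = (s ℤ.+ a ℤ.* + k) ℤ.%ℕ m
    τ k = (u ℤ.* (+ k ℤ.- s)) ℤ.%ℕ m
    σ<m : ∀ k → σ k ℕ.< m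
    σ<m k = n%ℕd<d (s ℤ.+ a ℤ.* + k) m
    τ<m : ∀ k → τ k ℕ.< m
    τ<m k = n%ℕd<d (u ℤ.* (+ k ℤ.- s)) m
    τσ : ∀ k → k ℕ.< m → τ (σ k) ≡ k
    τσ k k<m = %ℕ-unique m k (e ℤ.* + k ℤ.- u ℤ.* f) k<m
      (affine-inverseˡ {a} {u} {e} {+ m} au≡1 s (+ k) (+ (σ k)) f (a≡a%ℕn+[a/ℕn]*n (s ℤ.+ a ℤ.* + k) m))
      where f = (s ℤ.+ a ℤ.* + k) ℤ./ℕ m
    στ : ∀ k → k ℕ.< m → σ (τ k) ≡ k
    στ k k<m = %ℕ-unique m k (e ℤ.* (+ k ℤ.- s) ℤ.- a ℤ.* f) k<m
      (affine-inverseʳ {a} {u} {e} {+ m} au≡1 s (+ k) (+ (τ k)) f (a≡a%ℕn+[a/ℕn]*n (u ℤ.* (+ k ℤ.- s)) m))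
      where f = (u ℤ.* (+ k ℤ.- s)) ℤ./ℕ m

  private
    module ι = RingMorphisms.IsRingHomomorphism ι-hom

  -- Ssum and floorSum unfold to twistedSum χ̄₂ χ̄₁ c q₁ of their summands.
  twistedSum : (ψ φ : ℤ → Carrier) (m n : ℕ) → (ℕ → ℕ → ℚ) → Carrier
  twistedSum ψ φ m n f = ∑ m (λ j → ∑ n (λ i → ψ (+ j) * φ (+ i) * ι (f j i)))

  module TwistedSum (ψ φ : ℤ → Carrier) (m n : ℕ) where
    open NaturalCoefficients commutativeSemiring using (solve; _:+_; _:*_; _:=_)

    twistedSum-cong : ∀ {f g} → (∀ j → j ℕ.< m → ψ (+ j) ≈ 0# ⊎ (∀ i → f j i ≡ g j i)) →
                      twistedSum ψ φ m n f ≈ twistedSum ψ φ m n g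
    twistedSum-cong {f} {g} f≡g = sum-cong m (λ j j<m → sum-cong n (λ i _ → pointwise j i (f≡g j j<m)))
      where
      pointwise : ∀ j i → ψ (+ j) ≈ 0# ⊎ (∀ i → f j i ≡ g j i) →
                  ψ (+ j) * φ (+ i) * ι (f j i) ≈ ψ (+ j) * φ (+ i) * ι (g j i)
      pointwise j i (inj₁ ψj≈0) = ≈-trans (vanish (ι (f j i))) (≈-sym (vanish (ι (g j i))))
        where
        vanish : ∀ x → ψ (+ j) * φ (+ i) * x ≈ 0#
        vanish x = ≈-trans (*-congʳ (≈-trans (*-congʳ ψj≈0) (zeroˡ _))) (zeroˡ x)
      pointwise j i (inj₂ f≡g) = reflexive (cong (λ x → ψ (+ j) * φ (+ i) * ι x) (f≡g i))

    twistedSum-+ : ∀ (f g : ℕ → ℕ → ℚ) →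
                   twistedSum ψ φ m n (λ j i → f j i ℚ.+ g j i) ≈ twistedSum ψ φ m n f + twistedSum ψ φ m n g
    twistedSum-+ f g = ≈-trans
      (sum-cong m (λ j _ → ≈-trans (sum-cong n (λ i _ → split j i)) (sum-+ n _ _)))
      (sum-+ m _ _)
      where
      split : ∀ j i → ψ (+ j) * φ (+ i) * ι (f j i ℚ.+ g j i) ≈
                      ψ (+ j) * φ (+ i) * ι (f j i) + ψ (+ j) * φ (+ i) * ι (g j i)
      split j i = ≈-trans (*-congˡ (ι.+-homo (f j i) (g j i))) (distribˡ _ _ _)

    twistedSum-* : ∀ x (f : ℕ → ℕ → ℚ) →
                   twistedSum ψ φ m n (λ j i → x ℚ.* f j i) ≈ ι x * twistedSum ψ φ m n f
    twistedSum-* x f = ≈-trans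
      (sum-cong m (λ j _ → ≈-trans (sum-cong n (λ i _ → pull j i)) (sum-*ˡ n (ι x) _)))
      (sum-*ˡ m (ι x) _)
      where
      pull : ∀ j i → ψ (+ j) * φ (+ i) * ι (x ℚ.* f j i) ≈ ι x * (ψ (+ j) * φ (+ i) * ι (f j i))
      pull j i = ≈-trans (*-congˡ (ι.*-homo x (f j i)))
        (solve 4 (λ a b x y → a :* b :* (x :* y) := x :* (a :* b :* y)) ≈-refl (ψ (+ j)) (φ (+ i)) (ι x) (ι (f j i)))

    twistedSum-separable : ∀ (f g : ℕ → ℚ) → twistedSum ψ φ m n (λ j i → f j ℚ.* g i) ≈
                           ∑ m (λ j → ψ (+ j) * ι (f j)) * ∑ n (λ i → φ (+ i) * ι (g i))
    twistedSum-separable f g = ≈-trans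
      (sum-cong m (λ j _ → ≈-trans (sum-cong n (λ i _ → factor j i)) (sum-*ˡ n _ _)))
      (sum-*ʳ m _ _)
      where
      factor : ∀ j i → ψ (+ j) * φ (+ i) * ι (f j ℚ.* g i) ≈ (ψ (+ j) * ι (f j)) * (φ (+ i) * ι (g i))
      factor j i = ≈-trans (*-congˡ (ι.*-homo (f j) (g i)))
        (solve 4 (λ a b x y → a :* b :* (x :* y) := (a :* x) :* (b :* y)) ≈-refl (ψ (+ j)) (φ (+ i)) (ι (f j)) (ι (g i)))

  inverse-unique : ∀ {x a b} → a * x ≈ 1# → b * x ≈ 1# → a ≈ b
  inverse-unique {x} {a} {b} ax≈1 bx≈1 = begin
    a             ≈⟨ *-identityʳ a ⟨
    a * 1#        ≈⟨ *-congˡ bx≈1 ⟨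
    a * (b * x)   ≈⟨ solve 3 (λ a b x → a :* (b :* x) := b :* (a :* x)) ≈-refl a b x ⟩
    b * (a * x)   ≈⟨ *-congˡ ax≈1 ⟩
    b * 1#        ≈⟨ *-identityʳ b ⟩
    b             ∎
    where open NaturalCoefficients commutativeSemiring using (solve; _:*_; _:=_)

  x*s≈s⇒s≈0 : ∀ {x s} → ¬ (x ≈ 1#) → x * s ≈ s → s ≈ 0#
  x*s≈s⇒s≈0 {x} {s} x≉1 xs≈s with noZeroDivisors (1# - x) s (begin
      (1# - x) * s      ≈⟨ distribʳ s 1# (- x) ⟩
      1# * s + - x * s  ≈⟨ +-cong (*-identityˡ s) (≈-sym (-‿distribˡ-* x s)) ⟩
      s - x * s         ≈⟨ +-congˡ (-‿cong xs≈s) ⟩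
      s - s             ≈⟨ -‿inverseʳ s ⟩
      0#                ∎)
  ... | inj₁ 1-x≈0 = contradiction (≈-sym (x∙y⁻¹≈ε⇒x≈y 1# x 1-x≈0)) x≉1
  ... | inj₂ s≈0   = s≈0

  module DirichletCharacter {q} {χ χ̄ : ℤ → Carrier}
           (isχ : IsDirichletCharacter K q χ) (χ̄-conj : IsConjugate K q χ χ̄) where
    open IsDirichletCharacter isχ

    private
      instance
        q≢0 : NonZero q
        q≢0 = modulus-pos
      Unit : ℤ → Set
      Unit x = CoprimeTo K x q

    χ-periodicℤ : Periodic q χ
    χ-periodicℤ = periodic q χ χ-periodic

    χ̄χ≈1 : ∀ {x} → Unit x → χ̄ x * χ x ≈ 1#
    χ̄χ≈1 {x} = proj₁ (χ̄-conj x)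

    χ̄≈0 : ∀ {x} → ¬ Unit x → χ̄ x ≈ 0#
    χ̄≈0 {x} = proj₂ (χ̄-conj x)

    unit-shift : ∀ x t → Unit x → Unit (x ℤ.+ t ℤ.* + q)
    unit-shift x t = ℕ.coprime⇒gcd≡1 ∘ coprime-shift⁻¹ x t q ∘ ℕ.gcd≡1⇒coprime

    unit-shift⁻¹ : ∀ x t → Unit (x ℤ.+ t ℤ.* + q) → Unit x
    unit-shift⁻¹ x t = ℕ.coprime⇒gcd≡1 ∘ coprime-shift x t q ∘ ℕ.gcd≡1⇒coprime

    unit-* : ∀ {t x} → Unit t → Unit x → Unit (t ℤ.* x)
    unit-* {t} {x} t⊥q x⊥q = trans (cong (λ n → ℕ.gcd n q) (ℤP.abs-* t x))
      (ℕ.coprime⇒gcd≡1 (coprime-* {ℤ.∣ t ∣} {ℤ.∣ x ∣} (ℕ.gcd≡1⇒coprime t⊥q) (ℕ.gcd≡1⇒coprime x⊥q)))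

    unit-*-factor : ∀ t {x} → Unit (t ℤ.* x) → Unit x
    unit-*-factor t {x} tx⊥q = ℕ.coprime⇒gcd≡1 (coprime-*-factor ℤ.∣ t ∣
      (ℕ.gcd≡1⇒coprime (trans (cong (λ n → ℕ.gcd n q) (sym (ℤP.abs-* t x))) tx⊥q)))

    χ̄-periodic : Periodic q χ̄
    χ̄-periodic x t with ℕ.gcd ℤ.∣ x ∣ q ℕ.≟ 1
    ... | yes x⊥q = inverse-unique
      (≈-trans (*-congˡ (≈-sym (χ-periodicℤ x t))) (χ̄χ≈1 (unit-shift x t x⊥q))) (χ̄χ≈1 x⊥q)
    ... | no ¬x⊥q = ≈-trans (χ̄≈0 (¬x⊥q ∘ unit-shift⁻¹ x t)) (≈-sym (χ̄≈0 ¬x⊥q))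

    χ̄-twist : ∀ {t} → Unit t → ∀ x → χ̄ x ≈ χ t * χ̄ (t ℤ.* x)
    χ̄-twist {t} t⊥q x with ℕ.gcd ℤ.∣ x ∣ q ℕ.≟ 1
    ... | yes x⊥q = inverse-unique (χ̄χ≈1 x⊥q) (begin
      χ t * χ̄ (t ℤ.* x) * χ x     ≈⟨ solve 3 (λ a b c → a :* b :* c := b :* (a :* c)) ≈-refl (χ t) _ (χ x) ⟩
      χ̄ (t ℤ.* x) * (χ t * χ x)   ≈⟨ *-congˡ (χ-mult t x) ⟨
      χ̄ (t ℤ.* x) * χ (t ℤ.* x)   ≈⟨ χ̄χ≈1 (unit-* {t} {x} t⊥q x⊥q) ⟩
      1#                          ∎)
      where open NaturalCoefficients commutativeSemiring using (solve; _:*_; _:=_)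
    ... | no ¬x⊥q = begin
      χ̄ x                ≈⟨ χ̄≈0 ¬x⊥q ⟩
      0#                 ≈⟨ zeroʳ (χ t) ⟨
      χ t * 0#           ≈⟨ *-congˡ (χ̄≈0 (¬x⊥q ∘ unit-*-factor t)) ⟨
      χ t * χ̄ (t ℤ.* x)  ∎

    modulus≢1 : Nontrivial K q χ → q ≢ 1
    modulus≢1 (n , _ , χn≉1) refl = χn≉1 (begin
      χ n                                  ≡⟨ cong χ (solve 1 (λ n → n := con (+ 1) :+ (n :- con (+ 1)) :* con (+ 1)) refl n) ⟩
      χ (+ 1 ℤ.+ (n ℤ.- + 1) ℤ.* + 1)      ≈⟨ χ-periodicℤ (+ 1) (n ℤ.- + 1) ⟩
      χ (+ 1)                              ≈⟨ χ-one ⟩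
      1#                                   ∎)
      where open +-*-Solver

    χ̄-multiple : Nontrivial K q χ → ∀ {j} → q ∣ j → χ̄ (+ j) ≈ 0#
    χ̄-multiple nontrivial {j} q∣j = χ̄≈0 λ j⊥q →
      modulus≢1 nontrivial (ℕ.∣1⇒≡1 (subst (q ∣_) j⊥q (ℕ.gcd-greatest q∣j ℕ.∣-refl)))

    χ̄-sum : Nontrivial K q χ → ∑ q (χ̄ ∘ +_) ≈ 0#
    χ̄-sum (t , t⊥q , χt≉1) with modular-inverse t q (ℕ.gcd≡1⇒coprime t⊥q)
    ... | u , e , tu≡1 = x*s≈s⇒s≈0 χt≉1 (≈-sym (begin
      ∑ q (χ̄ ∘ +_)
        ≈⟨ sum-cong q (λ n _ → χ̄-twist t⊥q (+ n)) ⟩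
      ∑ q (λ n → χ t * χ̄ (t ℤ.* + n))
        ≈⟨ sum-*ˡ q (χ t) _ ⟩
      χ t * ∑ q (λ n → χ̄ (t ℤ.* + n))
        ≈⟨ *-congˡ (sum-cong q (λ n _ → reflexive (cong χ̄ (sym (ℤP.+-identityˡ (t ℤ.* + n)))))) ⟩
      χ t * ∑ q (λ n → χ̄ (+ 0 ℤ.+ t ℤ.* + n))
        ≈⟨ *-congˡ (sum-affine-invariant q χ̄-periodic {t} {u} {e} tu≡1 (+ 0)) ⟩
      χ t * ∑ q (χ̄ ∘ +_)
        ∎))

-- The terms of S(a, c), for c = r q₁ q₂

module Terms (q₁ q₂ r : ℕ) .{{_ : NonZero q₁}} .{{_ : NonZero q₂}} .{{_ : NonZero r}} (a : ℤ) where
  open +-*-Solver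

  M : ℕ
  M = r ℕ.* q₁

  instance
    M≢0 : NonZero M
    M≢0 = m*n≢0 r q₁

  c : ℕ
  c = M ℕ.* q₂

  instance
    c≢0 : NonZero c
    c≢0 = m*n≢0 M q₂

  W : ℚ
  W = + 1 ℚ./ M

  U : ℕ → ℚ
  U j = + (j ℕ./ q₂) ℚ./ 1

  X : ℕ → ℕ → ℚ
  X j n = + n ℚ./ q₁ ℚ.+ (a ℤ.* + j) ℚ./ c

  numerator : ℕ → ℕ → ℤ
  numerator j n = + n ℤ.* + r ℤ.* + q₂ ℤ.+ a ℤ.* + j

  +c≡ : + c ≡ + r ℤ.* + q₁ ℤ.* + q₂
  +c≡ = trans (ℤP.pos-* M q₂) (cong (ℤ._* + q₂) (ℤP.pos-* r q₁))

  X≡numerator/c : ∀ j n → X j n ≡ numerator j n ℚ./ c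
  X≡numerator/c j n = trans (+-/ (+ n) q₁ (a ℤ.* + j) c)
    (/-cross (+ n ℤ.* + c ℤ.+ a ℤ.* + j ℤ.* + q₁) (q₁ ℕ.* c) (numerator j n) c {{m*n≢0 q₁ c}} (begin
      (+ n ℤ.* + c ℤ.+ a ℤ.* + j ℤ.* + q₁) ℤ.* + c
        ≡⟨ cong (λ C → (+ n ℤ.* C ℤ.+ a ℤ.* + j ℤ.* + q₁) ℤ.* C) +c≡ ⟩
      (+ n ℤ.* (+ r ℤ.* + q₁ ℤ.* + q₂) ℤ.+ a ℤ.* + j ℤ.* + q₁) ℤ.* (+ r ℤ.* + q₁ ℤ.* + q₂)
        ≡⟨ solve 6 (λ n a j r q₁ q₂ → (n :* (r :* q₁ :* q₂) :+ a :* j :* q₁) :* (r :* q₁ :* q₂)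
                                    := (n :* r :* q₂ :+ a :* j) :* (q₁ :* (r :* q₁ :* q₂)))
                   refl (+ n) a (+ j) (+ r) (+ q₁) (+ q₂) ⟩
      numerator j n ℤ.* (+ q₁ ℤ.* (+ r ℤ.* + q₁ ℤ.* + q₂))
        ≡⟨ cong (λ C → numerator j n ℤ.* (+ q₁ ℤ.* C)) +c≡ ⟨
      numerator j n ℤ.* (+ q₁ ℤ.* + c)
        ≡⟨ cong (numerator j n ℤ.*_) (ℤP.pos-* q₁ c) ⟨
      numerator j n ℤ.* + (q₁ ℕ.* c)
        ∎))
    where open ≡-Reasoning

  +kq+l≡ : ∀ k q l → + (k ℕ.* q ℕ.+ l) ≡ + k ℤ.* + q ℤ.+ + l
  +kq+l≡ k q l = trans (ℤP.pos-+ (k ℕ.* q) l) (cong (ℤ._+ + l) (ℤP.pos-* k q))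

  numerator-block : ∀ k l n → numerator (k ℕ.* q₂ ℕ.+ l) n ≡ (+ n ℤ.* + r ℤ.+ a ℤ.* + k) ℤ.* + q₂ ℤ.+ a ℤ.* + l
  numerator-block k l n = trans (cong (λ j → + n ℤ.* + r ℤ.* + q₂ ℤ.+ a ℤ.* j) (+kq+l≡ k q₂ l))
    (solve 6 (λ n r q a k l → n :* r :* q :+ a :* (k :* q :+ l) := (n :* r :+ a :* k) :* q :+ a :* l)
             refl (+ n) (+ r) (+ q₂) a (+ k) (+ l))

  U*W≡ : ∀ j → U j ℚ.* W ≡ + (j ℕ./ q₂) ℚ./ M
  U*W≡ j = trans (*-/ (+ k) 1 (+ 1) M) (/-cross (+ k ℤ.* + 1) (1 ℕ.* M) (+ k) M {{m*n≢0 1 M}} (begin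
    + k ℤ.* + 1 ℤ.* + M       ≡⟨ solve 2 (λ k m → k :* con (+ 1) :* m := k :* (con (+ 1) :* m)) refl (+ k) (+ M) ⟩
    + k ℤ.* (+ 1 ℤ.* + M)     ≡⟨ cong (+ k ℤ.*_) (ℤP.pos-* 1 M) ⟨
    + k ℤ.* + (1 ℕ.* M)       ∎))
    where
    open ≡-Reasoning
    k = j ℕ./ q₂

  j/c≡ : ∀ j → + j ℚ./ c ≡ U j ℚ.* W ℚ.+ + (j ℕ.% q₂) ℚ./ c
  j/c≡ j = sym (begin
    U j ℚ.* W ℚ.+ + l ℚ./ c
      ≡⟨ cong (ℚ._+ + l ℚ./ c) (U*W≡ j) ⟩
    + k ℚ./ M ℚ.+ + l ℚ./ c
      ≡⟨ +-/ (+ k) M (+ l) c ⟩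
    ℚ._/_ (+ k ℤ.* + c ℤ.+ + l ℤ.* + M) (M ℕ.* c) {{m*n≢0 M c}}
      ≡⟨ /-cross (+ k ℤ.* + c ℤ.+ + l ℤ.* + M) (M ℕ.* c) (+ j) c {{m*n≢0 M c}} cross ⟩
    + j ℚ./ c
      ∎)
    where
    open ≡-Reasoning
    k = j ℕ./ q₂
    l = j ℕ.% q₂
    cross : (+ k ℤ.* + c ℤ.+ + l ℤ.* + M) ℤ.* + c ≡ + j ℤ.* + (M ℕ.* c)
    cross = begin
      (+ k ℤ.* + c ℤ.+ + l ℤ.* + M) ℤ.* + c
        ≡⟨ cong (λ C → (+ k ℤ.* C ℤ.+ + l ℤ.* + M) ℤ.* + c) (ℤP.pos-* M q₂) ⟩
      (+ k ℤ.* (+ M ℤ.* + q₂) ℤ.+ + l ℤ.* + M) ℤ.* + c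
        ≡⟨ solve 5 (λ k l m q c → (k :* (m :* q) :+ l :* m) :* c := (l :+ k :* q) :* (m :* c))
                   refl (+ k) (+ l) (+ M) (+ q₂) (+ c) ⟩
      (+ l ℤ.+ + k ℤ.* + q₂) ℤ.* (+ M ℤ.* + c)
        ≡⟨ cong₂ ℤ._*_ (trans (ℤP.pos-+ l (k ℕ.* q₂)) (cong (ℤ._+_ (+ l)) (ℤP.pos-* k q₂))) (ℤP.pos-* M c) ⟨
      + (l ℕ.+ k ℕ.* q₂) ℤ.* + (M ℕ.* c)
        ≡⟨ cong (λ j → + j ℤ.* + (M ℕ.* c)) (ℕ.m≡m%n+[m/n]*n j q₂) ⟨
      + j ℤ.* + (M ℕ.* c)
        ∎

  numerator-nonInteger : Coprime q₂ ℤ.∣ a ∣ → ∀ {j} n → ¬ q₂ ∣ j → ¬ c ∣ ℤ.∣ numerator j n ∣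
  numerator-nonInteger a⊥q₂ {j} n q₂∤j c∣P = q₂∤j (ℕ.coprime-divisor a⊥q₂ q₂∣aj)
    where
    q₂∣P : + q₂ ℤD.∣ numerator j n
    q₂∣P = ℤD.∣ᵤ⇒∣ (ℕ.∣-trans (ℕ.n∣m*n M) c∣P)
    q₂∣aj : q₂ ∣ ℤ.∣ a ∣ ℕ.* j
    q₂∣aj = subst (q₂ ∣_) (ℤP.abs-* a (+ j))
      (ℤD.∣⇒∣ᵤ (ℤD.∣m+n∣m⇒∣n q₂∣P (ℤD.∣n⇒∣m*n (+ n ℤ.* + r) (ℤD.∣-refl {+ q₂}))))

  Y : ℕ → ℚ
  Y j = (a ℤ.* + j) ℚ./ c

  -- The summands in the order of floorSum, not of X.
  ⌊X⌋ : ℕ → ℕ → ℚ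
  ⌊X⌋ j n = ℚ.floor (Y j ℚ.+ + n ℚ./ q₁) ℚ./ 1

  -- The factor 1ℚ exhibits constant-in-n as a function of j times a function of n.
  linear-in-n constant-in-n sawtooth-part floor-part : ℕ → ℕ → ℚ
  linear-in-n   j n = (U j ℚ.* W) ℚ.* (+ n ℚ./ q₁)
  constant-in-n j n = (U j ℚ.* W ℚ.* (Y j ℚ.- ℚ.½)) ℚ.* ℚ.1ℚ
  sawtooth-part j n = (+ (j ℕ.% q₂) ℚ./ c ℚ.- ℚ.½) ℚ.* sawtooth (X j n)
  floor-part    j n = U j ℚ.* ⌊X⌋ j n

  summand expanded-summand : ℕ → ℕ → ℚ
  summand j n = B₁ (+ j ℚ./ c) ℚ.* B₁ (X j n)
  expanded-summand j n = ((linear-in-n j n ℚ.+ constant-in-n j n) ℚ.+ sawtooth-part j n) ℚ.+ (ℚ.- W) ℚ.* floor-part j n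

  summand-expansion : Coprime q₂ ℤ.∣ a ∣ → ∀ {j} n → ¬ q₂ ∣ j → j ℕ.< c → summand j n ≡ expanded-summand j n
  summand-expansion a⊥q₂ {j} n q₂∤j j<c = begin
    summand j n
      ≡⟨ cong₂ ℚ._*_ B₁[j/c] B₁[X] ⟩
    (U j ℚ.* W ℚ.+ V ℚ.- ℚ.½) ℚ.* (X j n ℚ.- F ℚ.- ℚ.½)
      ≡⟨ product-expansion (U j) W V (+ n ℚ./ q₁) (Y j) F ℚ.½ ⟩
    non-floor-parts ℚ.+ (ℚ.- W) ℚ.* (U j ℚ.* F)
      ≡⟨ cong (λ G → non-floor-parts ℚ.+ (ℚ.- W) ℚ.* (U j ℚ.* G))
              (cong (λ x → ℚ.floor x ℚ./ 1) (ℚP.+-comm (+ n ℚ./ q₁) (Y j))) ⟩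
    expanded-summand j n
      ∎
    where
    open ≡-Reasoning
    V F non-floor-parts : ℚ
    V = + (j ℕ.% q₂) ℚ./ c
    F = ℚ.floor (X j n) ℚ./ 1
    non-floor-parts = (linear-in-n j n ℚ.+ constant-in-n j n) ℚ.+ sawtooth-part j n
    0<j : 0 ℕ.< j
    0<j = ℕP.n≢0⇒n>0 (λ j≡0 → q₂∤j (subst (q₂ ∣_) (sym j≡0) (q₂ ℕ.∣0)))
    B₁[j/c] : B₁ (+ j ℚ./ c) ≡ U j ℚ.* W ℚ.+ V ℚ.- ℚ.½
    B₁[j/c] = trans (B₁-proper c 0<j j<c) (cong (ℚ._- ℚ.½) (j/c≡ j))
    B₁[X] : B₁ (X j n) ≡ sawtooth (X j n)
    B₁[X] = begin
      B₁ (X j n)                        ≡⟨ cong B₁ (X≡numerator/c j n) ⟩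
      B₁ (numerator j n ℚ./ c)          ≡⟨ B₁-/ (numerator j n) c (numerator-nonInteger a⊥q₂ n q₂∤j) ⟩
      sawtooth (numerator j n ℚ./ c)    ≡⟨ cong sawtooth (X≡numerator/c j n) ⟨
      sawtooth (X j n)                  ∎

  Φ : ℕ → ℤ → ℚ
  Φ l z = sawtooth ((z ℤ.* + q₂ ℤ.+ a ℤ.* + l) ℚ./ c)

  Φ-periodic : ∀ l z t → Φ l (z ℤ.+ t ℤ.* + M) ≡ Φ l z
  Φ-periodic l z t = trans (cong (λ p → sawtooth (p ℚ./ c)) (begin
    (z ℤ.+ t ℤ.* + M) ℤ.* + q₂ ℤ.+ a ℤ.* + l
      ≡⟨ solve 5 (λ z t m q al → (z :+ t :* m) :* q :+ al := (z :* q :+ al) :+ t :* (m :* q))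
                 refl z t (+ M) (+ q₂) (a ℤ.* + l) ⟩
    (z ℤ.* + q₂ ℤ.+ a ℤ.* + l) ℤ.+ t ℤ.* (+ M ℤ.* + q₂)
      ≡⟨ cong (λ C → (z ℤ.* + q₂ ℤ.+ a ℤ.* + l) ℤ.+ t ℤ.* C) (ℤP.pos-* M q₂) ⟨
    (z ℤ.* + q₂ ℤ.+ a ℤ.* + l) ℤ.+ t ℤ.* + c
      ∎))
    (sawtooth-periodic (z ℤ.* + q₂ ℤ.+ a ℤ.* + l) t c)
    where open ≡-Reasoning

  sawtooth-part-block : ∀ k {l} n → l ℕ.< q₂ →
    sawtooth-part (k ℕ.* q₂ ℕ.+ l) n ≡ (+ l ℚ./ c ℚ.- ℚ.½) ℚ.* Φ l (+ n ℤ.* + r ℤ.+ a ℤ.* + k)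
  sawtooth-part-block k {l} n l<q₂ = cong₂ (λ m x → (+ m ℚ./ c ℚ.- ℚ.½) ℚ.* sawtooth x)
    ([kq+l]%q≡l k l<q₂) (trans (X≡numerator/c _ n) (cong (ℚ._/ c) (numerator-block k l n)))

module CharacterSums {ℓ₁ ℓ₂} (K : QDomain ℓ₁ ℓ₂)
  (q₁ q₂ r : ℕ) .{{_ : NonZero q₁}} .{{_ : NonZero q₂}} .{{_ : NonZero r}}
  {χ₁ χ₂ χ̄₁ χ̄₂ : ℤ → QDomain.Carrier K}
  (isχ₁ : IsDirichletCharacter K q₁ χ₁) (isχ₂ : IsDirichletCharacter K q₂ χ₂)
  (χ₁-nontrivial : Nontrivial K q₁ χ₁) (χ₂-nontrivial : Nontrivial K q₂ χ₂)
  (χ̄₁-conj : IsConjugate K q₁ χ₁ χ̄₁) (χ̄₂-conj : IsConjugate K q₂ χ₂ χ̄₂)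
  (a b d : ℤ) (det : a ℤ.* d ℤ.- b ℤ.* + (r ℕ.* q₁ ℕ.* q₂) ≡ + 1) where

  open QDomain K renaming (refl to ≈-refl; sym to ≈-sym; trans to ≈-trans)
  open Terms q₁ q₂ r a
  open import Relation.Binary.Reasoning.Setoid setoid
  open NaturalCoefficients commutativeSemiring using (_:*_; _:=_) renaming (solve to solve-K)
  private
    module χ₁ = DirichletCharacter K isχ₁ χ̄₁-conj
    module χ₂ = DirichletCharacter K isχ₂ χ̄₂-conj
    module ι = RingMorphisms.IsRingHomomorphism ι-hom
    ∑ : ℕ → (ℕ → Carrier) → Carrier
    ∑ = sumK K
  open TwistedSum K χ̄₂ χ̄₁ c q₁

  T : (ℕ → ℕ → ℚ) → Carrier
  T = twistedSum K χ̄₂ χ̄₁ c q₁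

  χ̄₂-block : ∀ k l → χ̄₂ (+ (k ℕ.* q₂ ℕ.+ l)) ≈ χ̄₂ (+ l)
  χ̄₂-block k l = ≈-trans (reflexive (cong χ̄₂ (trans (+kq+l≡ k q₂ l) (ℤP.+-comm (+ k ℤ.* + q₂) (+ l)))))
                         (χ₂.χ̄-periodic (+ l) (+ k))

  χ̄₂-weighted-by-quotient : ∀ (h : ℕ → Carrier) → ∑ c (λ j → χ̄₂ (+ j) * h (j ℕ./ q₂)) ≈ 0#
  χ̄₂-weighted-by-quotient h = begin
    ∑ c (λ j → χ̄₂ (+ j) * h (j ℕ./ q₂))
      ≈⟨ sum-blocks K M q₂ _ ⟩
    ∑ M (λ k → ∑ q₂ (λ l → χ̄₂ (+ (k ℕ.* q₂ ℕ.+ l)) * h ((k ℕ.* q₂ ℕ.+ l) ℕ./ q₂)))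
      ≈⟨ sum-cong K M (λ k _ → sum-cong K q₂ (λ l l<q₂ →
           *-cong (χ̄₂-block k l) (reflexive (cong h ([kq+l]/q≡k k l<q₂))))) ⟩
    ∑ M (λ k → ∑ q₂ (λ l → χ̄₂ (+ l) * h k))
      ≈⟨ sum-zero K M (λ k _ → ≈-trans (sum-*ʳ K q₂ (h k) _)
                                        (≈-trans (*-congʳ (χ₂.χ̄-sum χ₂-nontrivial)) (zeroˡ (h k)))) ⟩
    0#  ∎

  linear-in-n-vanishes : T linear-in-n ≈ 0#
  linear-in-n-vanishes = begin
    T linear-in-n                 ≈⟨ twistedSum-separable (λ j → U j ℚ.* W) (λ n → + n ℚ./ q₁) ⟩
    _ * _                         ≈⟨ *-congʳ (χ̄₂-weighted-by-quotient (λ k → ι (+ k ℚ./ 1 ℚ.* W))) ⟩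
    0# * _                        ≈⟨ zeroˡ _ ⟩
    0#                            ∎

  constant-in-n-vanishes : T constant-in-n ≈ 0#
  constant-in-n-vanishes = begin
    T constant-in-n               ≈⟨ twistedSum-separable (λ j → U j ℚ.* W ℚ.* (Y j ℚ.- ℚ.½)) (λ _ → ℚ.1ℚ) ⟩
    _ * ∑ q₁ (λ n → χ̄₁ (+ n) * ι ℚ.1ℚ)  ≈⟨ *-congˡ (sum-*ʳ K q₁ (ι ℚ.1ℚ) _) ⟩
    _ * (∑ q₁ (χ̄₁ ∘ +_) * ι ℚ.1ℚ)       ≈⟨ *-congˡ (*-congʳ (χ₁.χ̄-sum χ₁-nontrivial)) ⟩
    _ * (0# * ι ℚ.1ℚ)                   ≈⟨ *-congˡ (zeroˡ _) ⟩
    _ * 0#                              ≈⟨ zeroʳ _ ⟩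
    0#                                  ∎

  weight : ℕ → Carrier
  weight l = χ̄₂ (+ l) * ι (+ l ℚ./ c ℚ.- ℚ.½)

  ιΦ : ℕ → ℤ → Carrier
  ιΦ l z = ι (Φ l z)

  sawtooth-term-in-block : ∀ k {l} n → l ℕ.< q₂ →
    χ̄₂ (+ (k ℕ.* q₂ ℕ.+ l)) * χ̄₁ (+ n) * ι (sawtooth-part (k ℕ.* q₂ ℕ.+ l) n) ≈
    weight l * (χ̄₁ (+ n) * ιΦ l (+ n ℤ.* + r ℤ.+ a ℤ.* + k))
  sawtooth-term-in-block k {l} n l<q₂ = begin
    χ̄₂ (+ (k ℕ.* q₂ ℕ.+ l)) * χ̄₁ (+ n) * ι (sawtooth-part (k ℕ.* q₂ ℕ.+ l) n)
      ≈⟨ *-cong (*-congʳ (χ̄₂-block k l)) (reflexive (cong ι (sawtooth-part-block k n l<q₂))) ⟩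
    χ̄₂ (+ l) * χ̄₁ (+ n) * ι ((+ l ℚ./ c ℚ.- ℚ.½) ℚ.* Φ l (+ n ℤ.* + r ℤ.+ a ℤ.* + k))
      ≈⟨ *-congˡ (ι.*-homo _ _) ⟩
    χ̄₂ (+ l) * χ̄₁ (+ n) * (ι (+ l ℚ./ c ℚ.- ℚ.½) * ιΦ l (+ n ℤ.* + r ℤ.+ a ℤ.* + k))
      ≈⟨ solve-K 4 (λ x y v g → x :* y :* (v :* g) := x :* v :* (y :* g)) ≈-refl (χ̄₂ (+ l)) (χ̄₁ (+ n)) _ _ ⟩
    weight l * (χ̄₁ (+ n) * ιΦ l (+ n ℤ.* + r ℤ.+ a ℤ.* + k)) ∎

  ιΦ-sum-independent-of-n : ∀ l n → ∑ M (λ k → ιΦ l (+ n ℤ.* + r ℤ.+ a ℤ.* + k)) ≈ ∑ M (ιΦ l ∘ +_)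
  ιΦ-sum-independent-of-n l n = sum-affine-invariant K M (λ z t → reflexive (cong ι (Φ-periodic l z t)))
    {a} {d} {b ℤ.* + q₂} (det≡1⇒unit {a} {b} {d} M q₂ det) (+ n ℤ.* + r)

  residue-class-vanishes : ∀ l →
    ∑ M (λ k → ∑ q₁ (λ n → weight l * (χ̄₁ (+ n) * ιΦ l (+ n ℤ.* + r ℤ.+ a ℤ.* + k)))) ≈ 0#
  residue-class-vanishes l = begin
    ∑ M (λ k → ∑ q₁ (λ n → weight l * (χ̄₁ (+ n) * ιΦ l (+ n ℤ.* + r ℤ.+ a ℤ.* + k))))
      ≈⟨ sum-swap K M q₁ _ ⟩
    ∑ q₁ (λ n → ∑ M (λ k → weight l * (χ̄₁ (+ n) * ιΦ l (+ n ℤ.* + r ℤ.+ a ℤ.* + k))))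
      ≈⟨ sum-cong K q₁ (λ n _ → ≈-trans (sum-*ˡ K M (weight l) _)
           (*-congˡ (≈-trans (sum-*ˡ K M (χ̄₁ (+ n)) _) (*-congˡ (ιΦ-sum-independent-of-n l n))))) ⟩
    ∑ q₁ (λ n → weight l * (χ̄₁ (+ n) * C))
      ≈⟨ sum-cong K q₁ (λ n _ → solve-K 3 (λ x y z → x :* (y :* z) := x :* z :* y) ≈-refl (weight l) (χ̄₁ (+ n)) C) ⟩
    ∑ q₁ (λ n → weight l * C * χ̄₁ (+ n))
      ≈⟨ sum-*ˡ K q₁ _ _ ⟩
    weight l * C * ∑ q₁ (χ̄₁ ∘ +_)
      ≈⟨ *-congˡ (χ₁.χ̄-sum χ₁-nontrivial) ⟩
    weight l * C * 0#
      ≈⟨ zeroʳ _ ⟩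
    0# ∎
    where
    C = ∑ M (ιΦ l ∘ +_)

  sawtooth-part-vanishes : T sawtooth-part ≈ 0#
  sawtooth-part-vanishes = begin
    T sawtooth-part
      ≈⟨ sum-blocks K M q₂ _ ⟩
    ∑ M (λ k → ∑ q₂ (λ l → ∑ q₁ (λ n →
      χ̄₂ (+ (k ℕ.* q₂ ℕ.+ l)) * χ̄₁ (+ n) * ι (sawtooth-part (k ℕ.* q₂ ℕ.+ l) n))))
      ≈⟨ sum-cong K M (λ k _ → sum-cong K q₂ (λ l l<q₂ → sum-cong K q₁ (λ n _ → sawtooth-term-in-block k n l<q₂))) ⟩
    ∑ M (λ k → ∑ q₂ (λ l → ∑ q₁ (λ n → weight l * (χ̄₁ (+ n) * ιΦ l (+ n ℤ.* + r ℤ.+ a ℤ.* + k)))))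
      ≈⟨ sum-swap K M q₂ _ ⟩
    ∑ q₂ (λ l → ∑ M (λ k → ∑ q₁ (λ n → weight l * (χ̄₁ (+ n) * ιΦ l (+ n ℤ.* + r ℤ.+ a ℤ.* + k)))))
      ≈⟨ sum-zero K q₂ (λ l _ → residue-class-vanishes l) ⟩
    0# ∎

  T-summand-expansion : T summand ≈ T expanded-summand
  T-summand-expansion = twistedSum-cong split
    where
    split : ∀ j → j ℕ.< c → χ̄₂ (+ j) ≈ 0# ⊎ (∀ n → summand j n ≡ expanded-summand j n)
    split j j<c with q₂ ℕ.∣? j
    ... | yes q₂∣j = inj₁ (χ₂.χ̄-multiple χ₂-nontrivial q₂∣j)
    ... | no q₂∤j  = inj₂ (λ n → summand-expansion (det≡1⇒coprime {a} {b} {d} M q₂ det) n q₂∤j j<c)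

lemma3p2 : ∀ {c ℓ} (K : QDomain c ℓ) → let open QDomain K in
    (q₁ q₂ : ℕ) .{{_ : NonZero q₁}} .{{_ : NonZero q₂}}
    (χ₁ χ₂ χ̄₁ χ̄₂ : ℤ → Carrier) →
    IsDirichletCharacter K q₁ χ₁ → IsDirichletCharacter K q₂ χ₂ →
    Nontrivial K q₁ χ₁ → Nontrivial K q₂ χ₂ →
    Primitive K q₁ χ₁ → Primitive K q₂ χ₂ →
    IsConjugate K q₁ χ₁ χ̄₁ → IsConjugate K q₂ χ₂ χ̄₂ →
    χ₁ (ℤ.- + 1) * χ₂ (ℤ.- + 1) ≈ 1# →
    (a b d : ℤ) (r : ℕ) .{{_ : NonZero r}} →
    a ℤ.* d ℤ.- b ℤ.* + (r ℕ.* q₁ ℕ.* q₂) ≡ + 1 →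
    Ssum K χ̄₁ χ̄₂ q₁ a (r ℕ.* q₁ ℕ.* q₂) {{m*n≢0 (r ℕ.* q₁) q₂ {{m*n≢0 r q₁}}}}
      ≈ ι (ℚ.- ℚ._/_ (+ 1) (r ℕ.* q₁) {{m*n≢0 r q₁}})
        * floorSum K χ̄₁ χ̄₂ q₁ q₂ a (r ℕ.* q₁ ℕ.* q₂) {{m*n≢0 (r ℕ.* q₁) q₂ {{m*n≢0 r q₁}}}}
lemma3p2 K q₁ q₂ χ₁ χ₂ χ̄₁ χ̄₂ isχ₁ isχ₂ χ₁-nontrivial χ₂-nontrivial _ _ χ̄₁-conj χ̄₂-conj _ a b d r det =
  begin
  T summand
    ≈⟨ T-summand-expansion ⟩
  T expanded-summand
    ≈⟨ ≈-trans (twistedSum-+ _ _)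
         (+-cong (≈-trans (twistedSum-+ _ _) (+-congʳ (twistedSum-+ _ _))) (twistedSum-* (ℚ.- W) floor-part)) ⟩
  ((T linear-in-n + T constant-in-n) + T sawtooth-part) + ι (ℚ.- W) * T floor-part
    ≈⟨ +-congʳ (+-cong (+-cong linear-in-n-vanishes constant-in-n-vanishes) sawtooth-part-vanishes) ⟩
  ((0# + 0#) + 0#) + ι (ℚ.- W) * T floor-part
    ≈⟨ ≈-trans (+-congʳ (≈-trans (+-identityʳ _) (+-identityʳ 0#))) (+-identityˡ _) ⟩
  ι (ℚ.- W) * T floor-part ∎
  where
  open Terms q₁ q₂ r a
  open CharacterSums K q₁ q₂ r isχ₁ isχ₂ χ₁-nontrivial χ₂-nontrivial χ̄₁-conj χ̄₂-conj a b d det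
  open TwistedSum K χ̄₂ χ̄₁ c q₁
  open QDomain K using (_≈_; _*_; _+_; 0#; +-cong; +-congʳ; +-identityˡ; +-identityʳ; ι; setoid)
    renaming (trans to ≈-trans)
  open import Relation.Binary.Reasoning.Setoid setoid
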